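{- Fix a recursive representation on $\mathbb{N}$ of the universal poset $\mathbb{P}_0$ (the Fraïssé limit of the class of finite partial orders). Let $\mathcal{M}(\mathbb{P}_0)$ be the set of total orders on $\mathbb{N}$ that are linear extensions of the partial order of $\mathbb{P}_0$, and let $ML_\mu$ be the set of total orders on $\mathbb{N}$ that are Martin-Löf random relative to the Glasner–Weiss measure $\mu$. Then $ML_\mu\cap\mathcal{M}(\mathbb{P}_0)=\emptyset$.
   Context: A recursive representation of a countable structure is a bijection of its underlying set with $\mathbb{N}$ under which its relations become recursive. $\mathcal{M}$ is the set of total orders on $\mathbb{N}$, identified with a closed subset of $\{0,1\}^{(\mathbb{N}\times\mathbb{N})_{\ne}}$ (product topology) via $\xi(x,y)=1\iff x<_\xi y$; a permutation $\sigma$ of $\mathbb{N}$ acts by $x<_{\sigma\xi}y\iff\sigma^{ -1}x<_\xi\sigma^{ -1}y$. The Glasner–Weiss measure $\mu$ is the unique Borel probability measure on $\mathcal{M}$ invariant under the group $S_\infty$ of all permutations of $\mathbb{N}$. For a finite total order $\ell$ on a finite subset of $\mathbb{N}$, $Z_\ell=\{\xi\in\mathcal{M}:\xi\text{ extends }\ell\}$; $\mathcal{Z}$ is the Boolean algebra generated by these sets. A recursive representation of $\mathcal{Z}$ is an enumeration $(T_i)$ of $\mathcal{Z}$ such that from $i$ one can effectively obtain $T_i$ as a finite union of sets $Z_{\ell_1}^{\delta_1}\cap\dots\cap Z_{\ell_k}^{\delta_k}$ ($Z^1=Z$, $Z^0$ its complement). A set $A\subseteq\mathcal{M}$ has constructive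 measure $0$ if for some recursive representation $(T_i)$ of $\mathcal{Z}$ there is a total recursive $\phi:\mathbb{N}^2\to\mathbb{N}$ with $A\subseteq\bigcap_n\bigcup_m T_{\phi(n,m)}$ and $\mu(\bigcup_m T_{\phi(n,m)})$ converging effectively to $0$. $\xi$ is $\mu$-Martin-Löf random if it lies in no set of constructive measure $0$. -}

module Defs where

open import Data.Nat using (ℕ; zero; suc; _+_; _*_; _^_; _≤_; _<_; _≡ᵇ_)
open import Data.Nat using (_!)
open import Data.Bool using (Bool; true; false; if_then_else_; not; _∧_)
open import Data.Fin using (Fin)
open import Data.Vec using (Vec; []; _∷_; lookup)
open import Data.List using (List; []; _∷_; map; concat; concatMap; upTo; length; deduplicateᵇ; filterᵇ)
open import Data.Bool.ListAction using (all; any)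
open import Data.List.Relation.Unary.All using (All)
open import Data.List.Relation.Unary.Unique.Propositional using (Unique)
open import Data.Product using (Σ; _×_; _,_; proj₁)
open import Data.Sum using (_⊎_)
open import Relation.Binary.PropositionalEquality using (_≡_; _≢_)
open import Relation.Nullary using (¬_)
open import Function.Definitions using (Injective)

data Code : ℕ → Set where
  zer  : ∀ {n} → Code n
  succ : Code 1
  proj : ∀ {n} → Fin n → Code n
  comp : ∀ {m n} → Code m → Vec (Code n) m → Code n
  prec : ∀ {n} → Code n → Code (suc (suc n)) → Code (suc n)
  mini : ∀ {n} → Code (suc n) → Code n

mutual
  data Eval : ∀ {n} → Code n → Vec ℕ n → ℕ → Set where
    ev-zer   : ∀ {n} {xs : Vec ℕ n} → Eval zer xs 0
    ev-succ  : ∀ {x} → Eval succ (x ∷ []) (suc x)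
    ev-proj  : ∀ {n} {i : Fin n} {xs} → Eval (proj i) xs (lookup xs i)
    ev-comp  : ∀ {m n} {f : Code m} {gs : Vec (Code n) m} {xs ys r} →
               EvalAll gs xs ys → Eval f ys r → Eval (comp f gs) xs r
    ev-prec0 : ∀ {n} {f : Code n} {g} {xs r} →
               Eval f xs r → Eval (prec f g) (0 ∷ xs) r
    ev-precS : ∀ {n} {f : Code n} {g} {xs y r s} →
               Eval (prec f g) (y ∷ xs) r → Eval g (y ∷ r ∷ xs) s →
               Eval (prec f g) (suc y ∷ xs) s
    ev-mini  : ∀ {n} {f : Code (suc n)} {xs y} →
               Eval f (y ∷ xs) 0 →
               (∀ z → z < y → Σ ℕ λ w → Eval f (z ∷ xs) (suc w)) →
               Eval (mini f) xs y

  data EvalAll : ∀ {m n} → Vec (Code n) m → Vec ℕ n → Vec ℕ m → Set where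
    []  : ∀ {n} {xs : Vec ℕ n} → EvalAll [] xs []
    _∷_ : ∀ {m n} {g : Code n} {gs : Vec (Code n) m} {xs y ys} →
          Eval g xs y → EvalAll gs xs ys → EvalAll (g ∷ gs) xs (y ∷ ys)

Recursive : ∀ {n} → (Vec ℕ n → ℕ) → Set
Recursive {n} f = Σ (Code n) λ c → ∀ xs → Eval c xs (f xs)

Rec1 : (ℕ → ℕ) → Set
Rec1 f = Recursive {1} (λ { (x ∷ []) → f x })

Rec2 : (ℕ → ℕ → ℕ) → Set
Rec2 f = Recursive {2} (λ { (x ∷ y ∷ []) → f x y })

Rec3 : (ℕ → ℕ → ℕ → ℕ) → Set
Rec3 f = Recursive {3} (λ { (x ∷ y ∷ z ∷ []) → f x y z })

Rec4 : (ℕ → ℕ → ℕ → ℕ → ℕ) → Set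
Rec4 f = Recursive {4} (λ { (x ∷ y ∷ z ∷ w ∷ []) → f x y z w })

boolToℕ : Bool → ℕ
boolToℕ true  = 1
boolToℕ false = 0

record IsStrictPoset {A : Set} (r : A → A → Bool) : Set where
  field
    irrefl : ∀ x → r x x ≡ false
    trans  : ∀ x y z → r x y ≡ true → r y z ≡ true → r x z ≡ true

record IsTotalOrder (ξ : ℕ → ℕ → Bool) : Set where
  field
    irrefl : ∀ x → ξ x x ≡ false
    asym   : ∀ x y → ξ x y ≡ true → ξ y x ≡ false
    trans  : ∀ x y z → ξ x y ≡ true → ξ y z ≡ true → ξ x z ≡ true
    connex : ∀ x y → x ≢ y → ξ x y ≡ true ⊎ ξ y x ≡ true

-- A recursive representation on ℕ of the universal poset ℙ₀ (Fraïssé limit of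
-- finite posets): a recursive strict partial order on ℕ whose age is the class of
-- all finite posets and which is ultrahomogeneous.
record UniversalPosetRep (_≺_ : ℕ → ℕ → Bool) : Set where
  field
    recursive   : Rec2 (λ x y → boolToℕ (x ≺ y))
    poset       : IsStrictPoset _≺_
    age         : ∀ k (R : Fin k → Fin k → Bool) → IsStrictPoset R →
                  Σ (Fin k → ℕ) λ e → Injective _≡_ _≡_ e × (∀ i j → R i j ≡ (e i ≺ e j))
    homogeneous : ∀ k (a b : Fin k → ℕ) → Injective _≡_ _≡_ a → Injective _≡_ _≡_ b →
                  (∀ i j → (a i ≺ a j) ≡ (b i ≺ b j)) →
                  Σ (ℕ → ℕ) λ σ → Σ (ℕ → ℕ) λ τ →
                    (∀ x → σ (τ x) ≡ x) × (∀ x → τ (σ x) ≡ x) ×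
                    (∀ x y → (σ x ≺ σ y) ≡ (x ≺ y)) × (∀ i → σ (a i) ≡ b i)

LinExt : (ℕ → ℕ → Bool) → (ℕ → ℕ → Bool) → Set
LinExt _≺_ ξ = ∀ x y → (x ≺ y) ≡ true → ξ x y ≡ true

-- The Boolean algebra 𝒵, syntactically: finite unions of finite intersections
-- of Z_ℓ^δ.  A finite total order ℓ is a list of distinct naturals
-- [e₀, …, e_{L-1}] meaning e₀ < e₁ < … ; δ = true means Z_ℓ, false its complement.

Atom : Set
Atom = List ℕ × Bool

DNF : Set
DNF = List (List Atom)

ValidDNF : DNF → Set
ValidDNF D = All (All (λ a → Unique (proj₁ a))) D

extendsB : (ℕ → ℕ → Bool) → List ℕ → Bool
extendsB r []       = true
extendsB r (x ∷ xs) = all (r x) xs ∧ extendsB r xs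

atomB : (ℕ → ℕ → Bool) → Atom → Bool
atomB r (ℓ , true)  = extendsB r ℓ
atomB r (ℓ , false) = not (extendsB r ℓ)

evalDNF : (ℕ → ℕ → Bool) → DNF → Bool
evalDNF r D = any (all (atomB r)) D

-- The Glasner–Weiss measure on 𝒵: a set in 𝒵 only depends on the restriction of
-- ξ to the finite support F of its description, and μ is uniform on the |F|!
-- orders of F.  So μ(D) = #{orders π of F with π ∈ D} / |F|!.

support : DNF → List ℕ
support D = deduplicateᵇ _≡ᵇ_ (concatMap (concatMap proj₁) D)

insertions : ℕ → List ℕ → List (List ℕ)
insertions x []       = (x ∷ []) ∷ []
insertions x (y ∷ ys) = (x ∷ y ∷ ys) ∷ map (y ∷_) (insertions x ys)

perms : List ℕ → List (List ℕ)
perms []       = [] ∷ []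
perms (x ∷ xs) = concatMap (insertions x) (perms xs)

before : List ℕ → ℕ → ℕ → Bool
before []       x y = false
before (z ∷ zs) x y =
  if z ≡ᵇ x then any (_≡ᵇ y) zs else (if z ≡ᵇ y then false else before zs x y)

countSat : DNF → ℕ
countSat D = length (filterᵇ (λ π → evalDNF (before π) D) (perms (support D)))

MeasureLE : DNF → ℕ → Set
MeasureLE D k = countSat D * 2 ^ k ≤ length (support D) !

-- Recursive representations of 𝒵: T_i = ⋃_{j<nd i} ⋂_{k<nc i j} Z^{δ}_{ℓ(i,j,k)}
-- with ℓ(i,j,k) = [elt i j k 0 < … < elt i j k (len i j k - 1)] and
-- δ = (pol i j k ≠ 0), all data computed by recursive functions.

mkT : (ℕ → ℕ) → (ℕ → ℕ → ℕ) → (ℕ → ℕ → ℕ → ℕ) → (ℕ → ℕ → ℕ → ℕ → ℕ) →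
      (ℕ → ℕ → ℕ → ℕ) → ℕ → DNF
mkT nd nc len elt pol i =
  map (λ j → map (λ k → (map (elt i j k) (upTo (len i j k)) , not (pol i j k ≡ᵇ 0)))
                 (upTo (nc i j)))
      (upTo (nd i))

record ZRep : Set where
  field
    nd  : ℕ → ℕ
    nc  : ℕ → ℕ → ℕ
    len : ℕ → ℕ → ℕ → ℕ
    elt : ℕ → ℕ → ℕ → ℕ → ℕ
    pol : ℕ → ℕ → ℕ → ℕ
    nd-rec  : Rec1 nd
    nc-rec  : Rec2 nc
    len-rec : Rec3 len
    elt-rec : Rec4 elt
    pol-rec : Rec3 pol
    distinct : ∀ i j k p q → j < nd i → k < nc i j → p < q → q < len i j k →
               elt i j k p ≢ elt i j k q
    onto : ∀ (D : DNF) → ValidDNF D → Σ ℕ λ i →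
           ∀ ξ → IsTotalOrder ξ → evalDNF ξ (mkT nd nc len elt pol i) ≡ evalDNF ξ D

  T : ℕ → DNF
  T = mkT nd nc len elt pol

record MLTest : Set where
  field
    rep   : ZRep
    φ     : ℕ → ℕ → ℕ
    φ-rec : Rec2 φ
    -- effective convergence: μ(⋃_m T_{φ(n,m)}) ≤ 2^{-k} for n ≥ g k,
    -- expressed via all finite partial unions ⋃_{m<M}
    g     : ℕ → ℕ
    g-rec : Rec1 g
    small : ∀ k n M → g k ≤ n →
            MeasureLE (concatMap (λ m → ZRep.T rep (φ n m)) (upTo M)) k

Covered : MLTest → (ℕ → ℕ → Bool) → Set
Covered t ξ = ∀ n → Σ ℕ λ m → evalDNF ξ (ZRep.T (MLTest.rep t) (MLTest.φ t n m)) ≡ true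

MLRandom : (ℕ → ℕ → Bool) → Set
MLRandom ξ = ∀ (t : MLTest) → ¬ Covered t ξ

{-# OPTIONS --safe #-}
-- Every element x of ℙ₀ has some y ≺ x: embed a two-element chain and move its top to x by an
-- automorphism. Repeating a μ-search for the least such y gives a recursive descending chain
-- c₀ ≻ c₁ ≻ ⋯, and every linear extension ξ of ℙ₀ lies in Z_{ℓₙ} for ℓₙ = [cₙ < ⋯ < c₀]. Only one
-- of the (n+1)! orders of {c₀, …, cₙ} extends ℓₙ, so μ(Z_{ℓₙ}) = 1/(n+1)! ≤ 2⁻ⁿ and the sets Z_{ℓₙ}
-- form a Martin-Löf test containing ξ. Effectivity is witnessed by an enumeration of 𝒵 through
-- Cantor pairing, under which ℓₙ and all the data of the test are computed by μ-recursive codes.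
module Submission where

open import Defs

open import Data.Bool using (Bool; true; false; not; _∧_; T)
open import Data.Bool.ListAction using (all)
open import Data.Bool.Properties using (T-≡; ∧-zeroʳ)
open import Data.Empty using (⊥-elim)
open import Data.Fin as Fin using (Fin; #_)
open import Data.List
  using (List; []; _∷_; _++_; map; concat; concatMap; upTo; applyUpTo; applyDownFrom; length; filterᵇ; deduplicateᵇ)
open import Data.List.Membership.Propositional using (_∈_)
open import Data.List.Properties
  using (map-upTo; map-id; map-id-local; map-∘; map-applyUpTo; length-++; length-applyDownFrom;
         filter-++; filter-none; filter-all; ++-identityʳ)
open import Data.List.Relation.Unary.All as All using (All; []; _∷_)
import Data.List.Relation.Unary.All.Properties as All
open import Data.List.Relation.Unary.AllPairs as AllPairs using (AllPairs; []; _∷_)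
import Data.List.Relation.Unary.AllPairs.Properties as AllPairs
open import Data.List.Relation.Unary.Any using (here; there)
open import Data.List.Relation.Unary.Unique.Propositional using (Unique)
open import Data.Nat using (ℕ; zero; suc; _+_; _*_; _∸_; _^_; _≤_; _<_; z≤n; s≤s; pred; _≡ᵇ_; _!; ∣_-_∣)
open import Data.Nat.Properties
open import Data.Product using (Σ; _×_; _,_; proj₁; proj₂)
open import Data.Sum using (inj₁; inj₂)
open import Data.Vec using (Vec; []; _∷_)
open import Function using (_∘_; id)
open import Function.Bundles using (Equivalence)
open import Function.Definitions using (Injective)
open import Relation.Binary using (tri<; tri≈; tri>)
open import Relation.Binary.PropositionalEquality
  using (_≡_; _≢_; _≗_; refl; sym; trans; cong; cong₂; subst; module ≡-Reasoning)
open import Relation.Nullary using (¬_; yes; no)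
open import Relation.Nullary.Decidable using (T?)
open import Relation.Nullary.Negation using (contradiction)

Computes₁ : Code 1 → (ℕ → ℕ) → Set
Computes₁ c f = ∀ x → Eval c (x ∷ []) (f x)

Computes₂ : Code 2 → (ℕ → ℕ → ℕ) → Set
Computes₂ c f = ∀ x y → Eval c (x ∷ y ∷ []) (f x y)

Computes₃ : Code 3 → (ℕ → ℕ → ℕ → ℕ) → Set
Computes₃ c f = ∀ x y z → Eval c (x ∷ y ∷ z ∷ []) (f x y z)

π₀ : ∀ {n} → Code (suc n)
π₀ = proj (# 0)

π₁ : ∀ {n} → Code (suc (suc n))
π₁ = proj (# 1)

π₂ : ∀ {n} → Code (suc (suc (suc n)))
π₂ = proj (# 2)

π₃ : ∀ {n} → Code (suc (suc (suc (suc n))))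
π₃ = proj (# 3)

comp₁ : ∀ {n} → Code 1 → Code n → Code n
comp₁ f g = comp f (g ∷ [])

comp₂ : ∀ {n} → Code 2 → Code n → Code n → Code n
comp₂ f g h = comp f (g ∷ h ∷ [])

comp₃ : ∀ {n} → Code 3 → Code n → Code n → Code n → Code n
comp₃ f g h k = comp f (g ∷ h ∷ k ∷ [])

const-code : ∀ {n} → ℕ → Code n
const-code zero    = zer
const-code (suc c) = comp₁ succ (const-code c)

const-eval : ∀ {n} c {xs : Vec ℕ n} → Eval (const-code c) xs c
const-eval zero    = ev-zer
const-eval (suc c) = ev-comp (const-eval c ∷ []) ev-succ

pred-code : Code 1
pred-code = prec zer π₀

pred-eval : Computes₁ pred-code pred
pred-eval zero    = ev-prec0 ev-zer
pred-eval (suc x) = ev-precS (pred-eval x) ev-proj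

+-code : Code 2
+-code = prec π₀ (comp₁ succ π₁)

+-eval : Computes₂ +-code _+_
+-eval zero    y = ev-prec0 ev-proj
+-eval (suc x) y = ev-precS (+-eval x y) (ev-comp (ev-proj ∷ []) ev-succ)

*-code : Code 2
*-code = prec zer (comp₂ +-code π₂ π₁)

*-eval : Computes₂ *-code _*_
*-eval zero    y = ev-prec0 ev-zer
*-eval (suc x) y = ev-precS (*-eval x y) (ev-comp (ev-proj ∷ ev-proj ∷ []) (+-eval y (x * y)))

flip-∸-code : Code 2
flip-∸-code = prec π₀ (comp₁ pred-code π₁)

flip-∸-eval : Computes₂ flip-∸-code (λ y x → x ∸ y)
flip-∸-eval zero    x = ev-prec0 ev-proj
flip-∸-eval (suc y) x = ev-precS (flip-∸-eval y x)
  (subst (Eval _ _) (pred[m∸n]≡m∸[1+n] x y) (ev-comp (ev-proj ∷ []) (pred-eval (x ∸ y))))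

∸-code : Code 2
∸-code = comp₂ flip-∸-code π₁ π₀

∸-eval : Computes₂ ∸-code _∸_
∸-eval x y = ev-comp (ev-proj ∷ ev-proj ∷ []) (flip-∸-eval y x)

-- Cantor pairing and coded lists

tri : ℕ → ℕ
tri zero    = 0
tri (suc n) = tri n + suc n

tri-code : Code 1
tri-code = prec zer (comp₂ +-code π₁ (comp₁ succ π₀))

tri-eval : Computes₁ tri-code tri
tri-eval zero    = ev-prec0 ev-zer
tri-eval (suc n) = ev-precS (tri-eval n)
  (ev-comp (ev-proj ∷ ev-comp (ev-proj ∷ []) ev-succ ∷ []) (+-eval (tri n) (suc n)))

tri-mono-≤ : ∀ {m n} → m ≤ n → tri m ≤ tri n
tri-mono-≤ z≤n       = z≤n
tri-mono-≤ (s≤s m≤n) = +-mono-≤ (tri-mono-≤ m≤n) (s≤s m≤n)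

pair : ℕ → ℕ → ℕ
pair a b = tri (a + b) + b

pair-code : Code 2
pair-code = comp₂ +-code (comp₁ tri-code (comp₂ +-code π₀ π₁)) π₁

pair-eval : Computes₂ pair-code pair
pair-eval a b = ev-comp (ev-comp (ev-comp (ev-proj ∷ ev-proj ∷ []) (+-eval a b) ∷ []) (tri-eval (a + b)) ∷ ev-proj ∷ [])
  (+-eval (tri (a + b)) b)

-- 1 ∸ d is the indicator of d ≡ 0: the level goes up exactly when s + 1 reaches tri (level s + 1).
level : ℕ → ℕ
level zero    = 0
level (suc s) = level s + (1 ∸ (tri (suc (level s)) ∸ suc s))

level-code : Code 1
level-code =
  prec zer (comp₂ +-code π₁ (comp₂ ∸-code (const-code 1) (comp₂ ∸-code (comp₁ tri-code (comp₁ succ π₁)) (comp₁ succ π₀))))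

level-eval : Computes₁ level-code level
level-eval zero    = ev-prec0 ev-zer
level-eval (suc s) = ev-precS (level-eval s)
  (ev-comp (ev-proj ∷ ev-comp (const-eval 1 ∷ distance-to-next ∷ []) (∸-eval _ _) ∷ []) (+-eval _ _))
  where
    distance-to-next : Eval (comp₂ ∸-code (comp₁ tri-code (comp₁ succ π₁)) (comp₁ succ π₀))
                            (s ∷ level s ∷ []) (tri (suc (level s)) ∸ suc s)
    distance-to-next =
      ev-comp (ev-comp (ev-comp (ev-proj ∷ []) ev-succ ∷ []) (tri-eval _) ∷ ev-comp (ev-proj ∷ []) ev-succ ∷ []) (∸-eval _ _)

level-spec : ∀ s → tri (level s) ≤ s × s < tri (suc (level s))
level-spec zero = z≤n , s≤s z≤n
level-spec (suc s) with level-spec s | tri (suc (level s)) ≤? suc s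
... | _ , s<next | yes next≤1+s
  rewrite m≤n⇒m∸n≡0 next≤1+s | +-comm (level s) 1 | ≤-antisym next≤1+s s<next =
  ≤-refl , m<m+n (suc s) (s≤s z≤n)
... | lo , _ | no next≰1+s
  rewrite m≤n⇒m∸n≡0 {1} (m<n⇒0<n∸m (≰⇒> next≰1+s)) | +-identityʳ (level s) =
  m≤n⇒m≤1+n lo , ≰⇒> next≰1+s

level-unique : ∀ {s d e} → tri d ≤ s → s < tri (suc d) → tri e ≤ s → s < tri (suc e) → d ≡ e
level-unique {d = d} {e} lo₁ hi₁ lo₂ hi₂ with <-cmp d e
... | tri< d<e _ _ = ⊥-elim (<-irrefl refl (<-≤-trans hi₁ (≤-trans (tri-mono-≤ d<e) lo₂)))
... | tri≈ _ d≡e _ = d≡e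
... | tri> _ _ e<d = ⊥-elim (<-irrefl refl (<-≤-trans hi₂ (≤-trans (tri-mono-≤ e<d) lo₁)))

level-pair : ∀ a b → level (pair a b) ≡ a + b
level-pair a b = sym (level-unique (m≤m+n (tri (a + b)) b) pair<next lo hi)
  where
    pair<next : pair a b < tri (suc (a + b))
    pair<next = +-monoʳ-< (tri (a + b)) (s≤s (m≤n+m b a))
    lo = proj₁ (level-spec (pair a b))
    hi = proj₂ (level-spec (pair a b))

unpair₂ : ℕ → ℕ
unpair₂ s = s ∸ tri (level s)

unpair₁ : ℕ → ℕ
unpair₁ s = level s ∸ unpair₂ s

unpair₂-pair : ∀ a b → unpair₂ (pair a b) ≡ b
unpair₂-pair a b rewrite level-pair a b = m+n∸m≡n (tri (a + b)) b

unpair₁-pair : ∀ a b → unpair₁ (pair a b) ≡ a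
unpair₁-pair a b rewrite unpair₂-pair a b | level-pair a b = m+n∸n≡m a b

unpair₂-code : Code 1
unpair₂-code = comp₂ ∸-code π₀ (comp₁ tri-code (comp₁ level-code π₀))

unpair₂-eval : Computes₁ unpair₂-code unpair₂
unpair₂-eval s = ev-comp (ev-proj ∷ ev-comp (ev-comp (ev-proj ∷ []) (level-eval s) ∷ []) (tri-eval _) ∷ []) (∸-eval _ _)

unpair₁-code : Code 1
unpair₁-code = comp₂ ∸-code (comp₁ level-code π₀) unpair₂-code

unpair₁-eval : Computes₁ unpair₁-code unpair₁
unpair₁-eval s = ev-comp (ev-comp (ev-proj ∷ []) (level-eval s) ∷ unpair₂-eval s ∷ []) (∸-eval _ _)

skip : ℕ → ℕ → ℕ
skip zero    s = s
skip (suc t) s = unpair₂ (skip t s)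

nth : ℕ → ℕ → ℕ
nth s t = unpair₁ (skip t s)

⌜_⌝ : List ℕ → ℕ
⌜ [] ⌝     = 0
⌜ x ∷ xs ⌝ = pair x ⌜ xs ⌝

skip-unpair₂ : ∀ t s → skip t (unpair₂ s) ≡ skip (suc t) s
skip-unpair₂ zero    s = refl
skip-unpair₂ (suc t) s = cong unpair₂ (skip-unpair₂ t s)

nth-zero : ∀ x xs → nth ⌜ x ∷ xs ⌝ 0 ≡ x
nth-zero x xs = unpair₁-pair x ⌜ xs ⌝

nth-suc : ∀ x xs t → nth ⌜ x ∷ xs ⌝ (suc t) ≡ nth ⌜ xs ⌝ t
nth-suc x xs t = cong unpair₁ (trans (sym (skip-unpair₂ t (pair x ⌜ xs ⌝))) (cong (skip t) (unpair₂-pair x ⌜ xs ⌝)))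

nth-∈ : ∀ l {t} → t < length l → nth ⌜ l ⌝ t ∈ l
nth-∈ (x ∷ xs) {zero}  _         = here (nth-zero x xs)
nth-∈ (x ∷ xs) {suc t} (s≤s t<n) rewrite nth-suc x xs t = there (nth-∈ xs t<n)

applyUpTo-cong : ∀ {A : Set} {f g : ℕ → A} → f ≗ g → ∀ n → applyUpTo f n ≡ applyUpTo g n
applyUpTo-cong f≗g zero    = refl
applyUpTo-cong f≗g (suc n) = cong₂ _∷_ (f≗g 0) (applyUpTo-cong (f≗g ∘ suc) n)

applyUpTo-nth : ∀ {A : Set} (F : ℕ → A) l → applyUpTo (F ∘ nth ⌜ l ⌝) (length l) ≡ map F l
applyUpTo-nth F []       = refl
applyUpTo-nth F (x ∷ xs) = cong₂ _∷_ (cong F (nth-zero x xs))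
  (trans (applyUpTo-cong (cong F ∘ nth-suc x xs) (length xs)) (applyUpTo-nth F xs))

encodeList : List ℕ → ℕ
encodeList l = pair (length l) ⌜ l ⌝

decodeWith : ∀ {A : Set} → (ℕ → A) → ℕ → List A
decodeWith F s = map (F ∘ nth (unpair₂ s)) (upTo (unpair₁ s))

decodeWith-encodeList : ∀ {A : Set} (F : ℕ → A) l → decodeWith F (encodeList l) ≡ map F l
decodeWith-encodeList F l rewrite unpair₁-pair (length l) ⌜ l ⌝ | unpair₂-pair (length l) ⌜ l ⌝ =
  trans (map-upTo _ (length l)) (applyUpTo-nth F l)

skip-code : Code 2
skip-code = prec π₀ (comp₁ unpair₂-code π₁)

skip-eval : Computes₂ skip-code skip
skip-eval zero    s = ev-prec0 ev-proj
skip-eval (suc t) s = ev-precS (skip-eval t s) (ev-comp (ev-proj ∷ []) (unpair₂-eval _))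

nth-code : Code 2
nth-code = comp₁ unpair₁-code (comp₂ skip-code π₁ π₀)

nth-eval : Computes₂ nth-code nth
nth-eval s t = ev-comp (ev-comp (ev-proj ∷ ev-proj ∷ []) (skip-eval t s) ∷ []) (unpair₁-eval _)

∣m-n∣≡m∸n+n∸m : ∀ m n → ∣ m - n ∣ ≡ (m ∸ n) + (n ∸ m)
∣m-n∣≡m∸n+n∸m zero    zero    = refl
∣m-n∣≡m∸n+n∸m zero    (suc n) = refl
∣m-n∣≡m∸n+n∸m (suc m) zero    = sym (+-identityʳ (suc m))
∣m-n∣≡m∸n+n∸m (suc m) (suc n) = ∣m-n∣≡m∸n+n∸m m n

dist-code : Code 2
dist-code = comp₂ +-code (comp₂ ∸-code π₀ π₁) (comp₂ ∸-code π₁ π₀)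

dist-eval : Computes₂ dist-code ∣_-_∣
dist-eval x y = subst (Eval _ _) (sym (∣m-n∣≡m∸n+n∸m x y))
  (ev-comp (ev-comp (ev-proj ∷ ev-proj ∷ []) (∸-eval x y) ∷ ev-comp (ev-proj ∷ ev-proj ∷ []) (∸-eval y x) ∷ [])
           (+-eval _ _))

1∸∣m-n∣≡0⇒m≢n : ∀ {m n} → 1 ∸ ∣ m - n ∣ ≡ 0 → m ≢ n
1∸∣m-n∣≡0⇒m≢n {m} eq refl rewrite ∣n-n∣≡0 m with eq
... | ()

m≢n⇒1∸∣m-n∣≡0 : ∀ {m n} → m ≢ n → 1 ∸ ∣ m - n ∣ ≡ 0
m≢n⇒1∸∣m-n∣≡0 {m} {n} m≢n with ∣ m - n ∣ in eq
... | zero  = contradiction (∣m-n∣≡0⇒m≡n eq) m≢n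
... | suc d = 0∸n≡0 d

DistinctUpTo : ℕ → ℕ → Set
DistinctUpTo n s = ∀ {p q} → p < q → q < n → nth s p ≢ nth s q

-- 1 ∸ ∣ a - b ∣ is the indicator of a ≡ b.
earlierCopies : ℕ → ℕ → ℕ → ℕ
earlierCopies zero    q s = 0
earlierCopies (suc p) q s = earlierCopies p q s + (1 ∸ ∣ nth s p - nth s q ∣)

collisions : ℕ → ℕ → ℕ
collisions zero    s = 0
collisions (suc n) s = collisions n s + earlierCopies n n s

earlierCopies≡0⇒≢ : ∀ {p q s} → earlierCopies p q s ≡ 0 → ∀ {p′} → p′ < p → nth s p′ ≢ nth s q
earlierCopies≡0⇒≢ {suc p} {q} {s} eq p′<1+p with m<1+n⇒m<n∨m≡n p′<1+p
... | inj₁ p′<p  = earlierCopies≡0⇒≢ (m+n≡0⇒m≡0 (earlierCopies p q s) eq) p′<p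
... | inj₂ refl = 1∸∣m-n∣≡0⇒m≢n (m+n≡0⇒n≡0 (earlierCopies p q s) eq)

≢⇒earlierCopies≡0 : ∀ {p q s} → (∀ {p′} → p′ < p → nth s p′ ≢ nth s q) → earlierCopies p q s ≡ 0
≢⇒earlierCopies≡0 {zero}  _     = refl
≢⇒earlierCopies≡0 {suc p} fresh =
  cong₂ _+_ (≢⇒earlierCopies≡0 (fresh ∘ m<n⇒m<1+n)) (m≢n⇒1∸∣m-n∣≡0 (fresh ≤-refl))

collisions≡0⇒distinct : ∀ {n s} → collisions n s ≡ 0 → DistinctUpTo n s
collisions≡0⇒distinct {suc n} {s} eq p<q q<1+n with m<1+n⇒m<n∨m≡n q<1+n
... | inj₁ q<n  = collisions≡0⇒distinct (m+n≡0⇒m≡0 (collisions n s) eq) p<q q<n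
... | inj₂ refl = earlierCopies≡0⇒≢ (m+n≡0⇒n≡0 (collisions n s) eq) p<q

distinct⇒collisions≡0 : ∀ {n s} → DistinctUpTo n s → collisions n s ≡ 0
distinct⇒collisions≡0 {zero}  _        = refl
distinct⇒collisions≡0 {suc n} distinct =
  cong₂ _+_ (distinct⇒collisions≡0 (λ p<q → distinct p<q ∘ m<n⇒m<1+n))
            (≢⇒earlierCopies≡0 (λ p′<n → distinct p′<n ≤-refl))

unique⇒distinct : ∀ {l} → Unique l → DistinctUpTo (length l) ⌜ l ⌝
unique⇒distinct {x ∷ xs} (x∉xs ∷ _) {zero} {suc q} _ (s≤s q<n) eq
  rewrite nth-zero x xs | nth-suc x xs q = All.lookup x∉xs (nth-∈ xs q<n) eq
unique⇒distinct {x ∷ xs} (_ ∷ xs-unique) {suc p} {suc q} (s≤s p<q) (s≤s q<n)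
  rewrite nth-suc x xs p | nth-suc x xs q = unique⇒distinct xs-unique p<q q<n

equal-code : Code 2
equal-code = comp₂ ∸-code (const-code 1) dist-code

equal-eval : Computes₂ equal-code (λ x y → 1 ∸ ∣ x - y ∣)
equal-eval x y = ev-comp (const-eval 1 ∷ dist-eval x y ∷ []) (∸-eval _ _)

earlierCopies-code : Code 3
earlierCopies-code = prec zer (comp₂ +-code π₁ (comp₂ equal-code (comp₂ nth-code π₃ π₀) (comp₂ nth-code π₃ π₂)))

earlierCopies-eval : Computes₃ earlierCopies-code earlierCopies
earlierCopies-eval zero    q s = ev-prec0 ev-zer
earlierCopies-eval (suc p) q s = ev-precS (earlierCopies-eval p q s)
  (ev-comp (ev-proj ∷ ev-comp (ev-comp (ev-proj ∷ ev-proj ∷ []) (nth-eval s p)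
                              ∷ ev-comp (ev-proj ∷ ev-proj ∷ []) (nth-eval s q) ∷ [])
                             (equal-eval _ _) ∷ [])
           (+-eval _ _))

collisions-code : Code 2
collisions-code = prec zer (comp₂ +-code π₁ (comp₃ earlierCopies-code π₀ π₀ π₂))

collisions-eval : Computes₂ collisions-code collisions
collisions-eval zero    s = ev-prec0 ev-zer
collisions-eval (suc n) s = ev-precS (collisions-eval n s)
  (ev-comp (ev-proj ∷ ev-comp (ev-proj ∷ ev-proj ∷ ev-proj ∷ []) (earlierCopies-eval n n s) ∷ []) (+-eval _ _))

-- A code whose entries repeat is read as the empty order, so that every number codes a legal ℓ.
distinctLength : ℕ → ℕ
distinctLength s = unpair₁ s * (1 ∸ collisions (unpair₁ s) (unpair₂ s))

distinctLength-distinct : ∀ s → DistinctUpTo (distinctLength s) (unpair₂ s)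
distinctLength-distinct s {q = q} p<q q<len with collisions (unpair₁ s) (unpair₂ s) in eq
... | zero  = collisions≡0⇒distinct eq p<q (subst (q <_) (*-identityʳ (unpair₁ s)) q<len)
... | suc c = contradiction (subst (q <_) (trans (cong (unpair₁ s *_) (0∸n≡0 c)) (*-zeroʳ (unpair₁ s))) q<len) n≮0

distinctLength-encodeList : ∀ {l} → Unique l → distinctLength (encodeList l) ≡ length l
distinctLength-encodeList {l} l-unique
  rewrite unpair₁-pair (length l) ⌜ l ⌝ | unpair₂-pair (length l) ⌜ l ⌝
        | distinct⇒collisions≡0 (unique⇒distinct l-unique) = *-identityʳ (length l)

distinctLength-code : Code 1
distinctLength-code =
  comp₂ *-code unpair₁-code (comp₂ ∸-code (const-code 1) (comp₂ collisions-code unpair₁-code unpair₂-code))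

distinctLength-eval : Computes₁ distinctLength-code distinctLength
distinctLength-eval s =
  ev-comp (unpair₁-eval s ∷ ev-comp (const-eval 1 ∷ ev-comp (unpair₁-eval s ∷ unpair₂-eval s ∷ []) (collisions-eval _ _) ∷ [])
                                    (∸-eval _ _) ∷ [])
          (*-eval _ _)

decodeAtom : ℕ → Atom
decodeAtom a = map (nth (unpair₂ (unpair₂ a))) (upTo (distinctLength (unpair₂ a))) , not (unpair₁ a ≡ᵇ 0)

decodeDNF : ℕ → DNF
decodeDNF = decodeWith (decodeWith decodeAtom)

encodeAtom : Atom → ℕ
encodeAtom (ℓ , δ) = pair (boolToℕ δ) (encodeList ℓ)

encodeDNF : DNF → ℕ
encodeDNF D = encodeList (map (encodeList ∘ map encodeAtom) D)

decodeAtom-encodeAtom : ∀ {ℓ} δ → Unique ℓ → decodeAtom (encodeAtom (ℓ , δ)) ≡ (ℓ , δ)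
decodeAtom-encodeAtom {ℓ} δ ℓ-unique
  rewrite unpair₁-pair (boolToℕ δ) (encodeList ℓ) | unpair₂-pair (boolToℕ δ) (encodeList ℓ)
        | distinctLength-encodeList ℓ-unique | unpair₂-pair (length ℓ) ⌜ ℓ ⌝ =
  cong₂ _,_ (trans (map-upTo _ (length ℓ)) (trans (applyUpTo-nth id ℓ) (map-id ℓ))) (not-boolToℕ≡ᵇ0 δ)
  where
    not-boolToℕ≡ᵇ0 : ∀ δ → not (boolToℕ δ ≡ᵇ 0) ≡ δ
    not-boolToℕ≡ᵇ0 true  = refl
    not-boolToℕ≡ᵇ0 false = refl

decodeDNF-encodeDNF : ∀ {D} → ValidDNF D → decodeDNF (encodeDNF D) ≡ D
decodeDNF-encodeDNF {D} D-valid = begin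
  decodeDNF (encodeDNF D)
    ≡⟨ decodeWith-encodeList _ (map (encodeList ∘ map encodeAtom) D) ⟩
  map (decodeWith decodeAtom) (map (encodeList ∘ map encodeAtom) D)
    ≡⟨ map-∘ D ⟨
  map (decodeWith decodeAtom ∘ encodeList ∘ map encodeAtom) D
    ≡⟨ map-id-local (All.map decode-encode-conjunct D-valid) ⟩
  D ∎
  where
    open ≡-Reasoning

    decode-encode-conjunct : ∀ {C} → All (Unique ∘ proj₁) C → decodeWith decodeAtom (encodeList (map encodeAtom C)) ≡ C
    decode-encode-conjunct {C} C-valid = begin
      decodeWith decodeAtom (encodeList (map encodeAtom C)) ≡⟨ decodeWith-encodeList decodeAtom (map encodeAtom C) ⟩
      map decodeAtom (map encodeAtom C)                      ≡⟨ map-∘ C ⟨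
      map (decodeAtom ∘ encodeAtom) C
        ≡⟨ map-id-local (All.map (λ {(_ , δ)} → decodeAtom-encodeAtom δ) C-valid) ⟩
      C                                                      ∎

conjunctCode : ℕ → ℕ → ℕ
conjunctCode i j = nth (unpair₂ i) j

atomCode : ℕ → ℕ → ℕ → ℕ
atomCode i j k = nth (unpair₂ (conjunctCode i j)) k

orderCode : ℕ → ℕ → ℕ → ℕ
orderCode i j k = unpair₂ (atomCode i j k)

conjunctCode-code : Code 2
conjunctCode-code = comp₂ nth-code (comp₁ unpair₂-code π₀) π₁

conjunctCode-eval : Computes₂ conjunctCode-code conjunctCode
conjunctCode-eval i j = ev-comp (ev-comp (ev-proj ∷ []) (unpair₂-eval i) ∷ ev-proj ∷ []) (nth-eval _ j)

atomCode-code : Code 3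
atomCode-code = comp₂ nth-code (comp₁ unpair₂-code (comp₂ conjunctCode-code π₀ π₁)) π₂

atomCode-eval : Computes₃ atomCode-code atomCode
atomCode-eval i j k =
  ev-comp (ev-comp (ev-comp (ev-proj ∷ ev-proj ∷ []) (conjunctCode-eval i j) ∷ []) (unpair₂-eval _) ∷ ev-proj ∷ [])
          (nth-eval _ k)

orderCode-code : Code 3
orderCode-code = comp₁ unpair₂-code atomCode-code

orderCode-eval : Computes₃ orderCode-code orderCode
orderCode-eval i j k = ev-comp (atomCode-eval i j k ∷ []) (unpair₂-eval _)

codeRep : ZRep
codeRep = record
  { nd       = unpair₁
  ; nc       = λ i j → unpair₁ (conjunctCode i j)
  ; len      = λ i j k → distinctLength (orderCode i j k)
  ; elt      = λ i j k → nth (unpair₂ (orderCode i j k))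
  ; pol      = λ i j k → unpair₁ (atomCode i j k)
  ; nd-rec   = unpair₁-code , λ { (i ∷ []) → unpair₁-eval i }
  ; nc-rec   = comp₁ unpair₁-code conjunctCode-code ,
               λ { (i ∷ j ∷ []) → ev-comp (conjunctCode-eval i j ∷ []) (unpair₁-eval _) }
  ; len-rec  = comp₁ distinctLength-code orderCode-code ,
               λ { (i ∷ j ∷ k ∷ []) → ev-comp (orderCode-eval i j k ∷ []) (distinctLength-eval _) }
  ; elt-rec  = comp₂ nth-code (comp₃ (comp₁ unpair₂-code orderCode-code) π₀ π₁ π₂) π₃ ,
               λ { (i ∷ j ∷ k ∷ p ∷ []) →
                   ev-comp (ev-comp (ev-proj ∷ ev-proj ∷ ev-proj ∷ []) (ev-comp (orderCode-eval i j k ∷ []) (unpair₂-eval _))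
                            ∷ ev-proj ∷ []) (nth-eval _ p) }
  ; pol-rec  = comp₁ unpair₁-code atomCode-code ,
               λ { (i ∷ j ∷ k ∷ []) → ev-comp (atomCode-eval i j k ∷ []) (unpair₁-eval _) }
  ; distinct = λ i j k p q _ _ → distinctLength-distinct (orderCode i j k)
  ; onto     = λ D D-valid → encodeDNF D , λ ξ _ → cong (evalDNF ξ) (decodeDNF-encodeDNF D-valid)
  }

-- Counting the orders of a finite set that extend a chain

countᵇ : ∀ {A : Set} → (A → Bool) → List A → ℕ
countᵇ p l = length (filterᵇ p l)

countᵇ-∷ : ∀ {A : Set} (p : A → Bool) x l → countᵇ p (x ∷ l) ≡ boolToℕ (p x) + countᵇ p l
countᵇ-∷ p x l with p x
... | true  = refl
... | false = refl

countᵇ-++ : ∀ {A : Set} (p : A → Bool) l m → countᵇ p (l ++ m) ≡ countᵇ p l + countᵇ p m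
countᵇ-++ p l m = trans (cong length (filter-++ (T? ∘ p) l m)) (length-++ (filterᵇ p l))

countᵇ-cong : ∀ {A : Set} {p q : A → Bool} → p ≗ q → countᵇ p ≗ countᵇ q
countᵇ-cong {p = p} {q} p≗q []      = refl
countᵇ-cong {p = p} {q} p≗q (x ∷ l) = begin
  countᵇ p (x ∷ l)               ≡⟨ countᵇ-∷ p x l ⟩
  boolToℕ (p x) + countᵇ p l     ≡⟨ cong₂ _+_ (cong boolToℕ (p≗q x)) (countᵇ-cong p≗q l) ⟩
  boolToℕ (q x) + countᵇ q l     ≡⟨ countᵇ-∷ q x l ⟨
  countᵇ q (x ∷ l)               ∎
  where open ≡-Reasoning

boolToℕ-∧-≤ : ∀ a b → boolToℕ (a ∧ b) ≤ boolToℕ b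
boolToℕ-∧-≤ true  b = ≤-refl
boolToℕ-∧-≤ false b = z≤n

extendsᵇ : List ℕ → List ℕ → Bool
extendsᵇ π ℓ = extendsB (before π) ℓ

x≢y⇒x≡ᵇy≡false : ∀ {x y} → x ≢ y → (x ≡ᵇ y) ≡ false
x≢y⇒x≡ᵇy≡false {x} {y} x≢y with x ≡ᵇ y in eq
... | true  = contradiction (≡ᵇ⇒≡ x y (Equivalence.from T-≡ eq)) x≢y
... | false = refl

x≡ᵇx : ∀ x → (x ≡ᵇ x) ≡ true
x≡ᵇx x = Equivalence.to T-≡ (≡⇒≡ᵇ x x refl)

before-∷-fresh : ∀ {x σ a b} → x ≢ a → x ≢ b → before (x ∷ σ) a b ≡ before σ a b
before-∷-fresh x≢a x≢b rewrite x≢y⇒x≡ᵇy≡false x≢a | x≢y⇒x≡ᵇy≡false x≢b = refl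

extendsᵇ-∷-fresh : ∀ {x σ ℓ} → All (x ≢_) ℓ → extendsᵇ (x ∷ σ) ℓ ≡ extendsᵇ σ ℓ
extendsᵇ-∷-fresh                 []            = refl
extendsᵇ-∷-fresh {x} {σ} {y ∷ ℓ} (x≢y ∷ x∉ℓ) =
  cong₂ _∧_ (all-cong (All.map (before-∷-fresh {σ = σ} x≢y) x∉ℓ)) (extendsᵇ-∷-fresh {σ = σ} x∉ℓ)
  where
    all-cong : ∀ {p q : ℕ → Bool} {l} → All (λ z → p z ≡ q z) l → all p l ≡ all q l
    all-cong []         = refl
    all-cong (eq ∷ eqs) = cong₂ _∧_ eq (all-cong eqs)

-- The listing z ∷ τ puts z first, so it cannot extend an order in which x precedes z.
extendsᵇ-head : ∀ {x z τ ℓ} → x ≢ z → z ∈ ℓ → extendsᵇ (z ∷ τ) (x ∷ ℓ) ≡ false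
extendsᵇ-head {x} {z} {τ} {ℓ} x≢z z∈ℓ = cong (_∧ extendsᵇ (z ∷ τ) ℓ) (all-false z∈ℓ z-not-after-x)
  where
    z-not-after-x : before (z ∷ τ) x z ≡ false
    z-not-after-x rewrite x≢y⇒x≡ᵇy≡false (x≢z ∘ sym) | x≡ᵇx z = refl

    all-false : ∀ {p : ℕ → Bool} {l} → z ∈ l → p z ≡ false → all p l ≡ false
    all-false {p} {y ∷ l} (here refl)  pz≡false rewrite pz≡false = refl
    all-false {p} {y ∷ l} (there z∈l) pz≡false = trans (cong (p y ∧_) (all-false z∈l pz≡false)) (∧-zeroʳ (p y))

countᵇ-insertions : ∀ {x ℓ} σ → All (x ≢_) ℓ → All (_∈ ℓ) σ →
                    countᵇ (λ π → extendsᵇ π (x ∷ ℓ)) (insertions x σ) ≤ boolToℕ (extendsᵇ σ ℓ)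
countᵇ-insertions {x} {ℓ} σ x∉ℓ σ⊆ℓ = begin
  countᵇ p (insertions x σ)
    ≡⟨ only-head-counts σ σ⊆ℓ ⟩
  boolToℕ (p (x ∷ σ))
    ≡⟨ cong (λ b → boolToℕ (all (before (x ∷ σ) x) ℓ ∧ b)) (extendsᵇ-∷-fresh {σ = σ} x∉ℓ) ⟩
  boolToℕ (all (before (x ∷ σ) x) ℓ ∧ extendsᵇ σ ℓ)
    ≤⟨ boolToℕ-∧-≤ _ _ ⟩
  boolToℕ (extendsᵇ σ ℓ) ∎
  where
    open ≤-Reasoning
    p : List ℕ → Bool
    p π = extendsᵇ π (x ∷ ℓ)

    only-head-counts : ∀ σ → All (_∈ ℓ) σ → countᵇ p (insertions x σ) ≡ boolToℕ (p (x ∷ σ))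
    only-head-counts []      _           = trans (countᵇ-∷ p (x ∷ []) []) (+-identityʳ _)
    only-head-counts (z ∷ τ) (z∈ℓ ∷ _)  = begin-equality
      countᵇ p (insertions x (z ∷ τ))
        ≡⟨ countᵇ-∷ p (x ∷ z ∷ τ) _ ⟩
      boolToℕ (p (x ∷ z ∷ τ)) + countᵇ p (map (z ∷_) (insertions x τ))
        ≡⟨ cong (boolToℕ (p (x ∷ z ∷ τ)) +_) (none (insertions x τ)) ⟩
      boolToℕ (p (x ∷ z ∷ τ)) + 0
        ≡⟨ +-identityʳ _ ⟩
      boolToℕ (p (x ∷ z ∷ τ)) ∎
      where
        none : ∀ L → countᵇ p (map (z ∷_) L) ≡ 0
        none L = cong length (filter-none (T? ∘ p) (All.map⁺ {xs = L} (All.tabulate (λ {π} _ →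
          subst T (extendsᵇ-head {τ = π} (All.lookup x∉ℓ z∈ℓ) z∈ℓ)))))

insertions-⊆ : ∀ {x m} σ → x ∈ m → All (_∈ m) σ → All (All (_∈ m)) (insertions x σ)
insertions-⊆ []      x∈m []          = (x∈m ∷ []) ∷ []
insertions-⊆ (y ∷ σ) x∈m (y∈m ∷ σ⊆m) =
  (x∈m ∷ y∈m ∷ σ⊆m) ∷ All.map⁺ (All.map (y∈m ∷_) (insertions-⊆ σ x∈m σ⊆m))

perms-⊆ : ∀ ℓ → All (All (_∈ ℓ)) (perms ℓ)
perms-⊆ []      = [] ∷ []
perms-⊆ (x ∷ ℓ) =
  All.concat⁺ (All.map⁺ (All.map (λ {σ} σ⊆ℓ → insertions-⊆ σ (here refl) (All.map there σ⊆ℓ)) (perms-⊆ ℓ)))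

-- Only the listing of ℓ itself extends ℓ; an upper bound is all that is needed.
countᵇ-perms : ∀ {ℓ} → Unique ℓ → countᵇ (λ π → extendsᵇ π ℓ) (perms ℓ) ≤ 1
countᵇ-perms {[]}    _                   = ≤-refl
countᵇ-perms {x ∷ ℓ} (x∉ℓ ∷ ℓ-unique) =
  ≤-trans (sum (perms ℓ) (perms-⊆ ℓ)) (countᵇ-perms ℓ-unique)
  where
    sum : ∀ S → All (All (_∈ ℓ)) S →
          countᵇ (λ π → extendsᵇ π (x ∷ ℓ)) (concatMap (insertions x) S) ≤ countᵇ (λ σ → extendsᵇ σ ℓ) S
    sum []      []            = z≤n
    sum (σ ∷ S) (σ⊆ℓ ∷ S⊆ℓ) = begin
      countᵇ _ (insertions x σ ++ concatMap (insertions x) S)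
        ≡⟨ countᵇ-++ _ (insertions x σ) _ ⟩
      countᵇ _ (insertions x σ) + countᵇ _ (concatMap (insertions x) S)
        ≤⟨ +-mono-≤ (countᵇ-insertions σ x∉ℓ σ⊆ℓ) (sum S S⊆ℓ) ⟩
      boolToℕ (extendsᵇ σ ℓ) + countᵇ _ S
        ≡⟨ countᵇ-∷ _ σ S ⟨
      countᵇ (λ σ → extendsᵇ σ ℓ) (σ ∷ S) ∎
      where open ≤-Reasoning

deduplicateᵇ-unique : ∀ {l} → Unique l → deduplicateᵇ _≡ᵇ_ l ≡ l
deduplicateᵇ-unique {[]}     _                = refl
deduplicateᵇ-unique {x ∷ xs} (x∉xs ∷ xs-unique) rewrite deduplicateᵇ-unique xs-unique =
  cong (x ∷_) (filter-all _ (All.map (λ {y} x≢y → x≢y ∘ ≡ᵇ⇒≡ x y) x∉xs))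

Z : List ℕ → DNF
Z ℓ = ((ℓ , true) ∷ []) ∷ []

evalDNF-Z : ∀ r ℓ → evalDNF r (Z ℓ) ≡ extendsB r ℓ
evalDNF-Z r ℓ with extendsB r ℓ
... | true  = refl
... | false = refl

support-Z : ∀ {ℓ} → Unique ℓ → support (Z ℓ) ≡ ℓ
support-Z {ℓ} ℓ-unique =
  trans (cong (deduplicateᵇ _≡ᵇ_) (trans (++-identityʳ _) (++-identityʳ ℓ))) (deduplicateᵇ-unique ℓ-unique)

countSat-Z : ∀ {ℓ} → Unique ℓ → countSat (Z ℓ) ≤ 1
countSat-Z {ℓ} ℓ-unique = begin
  countSat (Z ℓ)
    ≡⟨ cong (countᵇ (λ π → evalDNF (before π) (Z ℓ)) ∘ perms) (support-Z ℓ-unique) ⟩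
  countᵇ (λ π → evalDNF (before π) (Z ℓ)) (perms ℓ)
    ≡⟨ countᵇ-cong (λ π → evalDNF-Z (before π) ℓ) (perms ℓ) ⟩
  countᵇ (λ π → extendsᵇ π ℓ) (perms ℓ)
    ≤⟨ countᵇ-perms ℓ-unique ⟩
  1 ∎
  where open ≤-Reasoning

measure-Z : ∀ {ℓ} k → Unique ℓ → 2 ^ k ≤ length ℓ ! → MeasureLE (Z ℓ) k
measure-Z {ℓ} k ℓ-unique 2^k≤ℓ! = begin
  countSat (Z ℓ) * 2 ^ k    ≤⟨ *-monoˡ-≤ (2 ^ k) (countSat-Z ℓ-unique) ⟩
  1 * 2 ^ k                 ≡⟨ *-identityˡ (2 ^ k) ⟩
  2 ^ k                     ≤⟨ 2^k≤ℓ! ⟩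
  length ℓ !                ≡⟨ cong (_! ∘ length) (support-Z ℓ-unique) ⟨
  length (support (Z ℓ)) !  ∎
  where open ≤-Reasoning

!-mono-≤ : ∀ {m n} → m ≤ n → m ! ≤ n !
!-mono-≤ {n = zero}  z≤n = ≤-refl
!-mono-≤ {m} {suc n} m≤1+n with m<1+n⇒m<n∨m≡n (s≤s m≤1+n)
... | inj₁ m≤n  = ≤-trans (!-mono-≤ (≤-pred m≤n)) (m≤m+n (n !) (n * n !))
... | inj₂ refl = ≤-refl

2^n≤[1+n]! : ∀ n → 2 ^ n ≤ suc n !
2^n≤[1+n]! zero    = ≤-refl
2^n≤[1+n]! (suc n) = *-mono-≤ {2} {suc (suc n)} (s≤s (s≤s z≤n)) (2^n≤[1+n]! n)

concat-applyUpTo-[] : ∀ {A : Set} {f : ℕ → List A} → (∀ m → f m ≡ []) → ∀ M → concat (applyUpTo f M) ≡ []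
concat-applyUpTo-[] f≡[] zero    = refl
concat-applyUpTo-[] f≡[] (suc M) rewrite f≡[] 0 = concat-applyUpTo-[] (f≡[] ∘ suc) M

concatMap-upTo-suc : ∀ {A : Set} (f : ℕ → List A) M → (∀ m → f (suc m) ≡ []) → concatMap f (upTo (suc M)) ≡ f 0
concatMap-upTo-suc f M f[1+m]≡[] = begin
  f 0 ++ concat (map f (applyUpTo suc M)) ≡⟨ cong (λ L → f 0 ++ concat L) (map-applyUpTo suc f M) ⟩
  f 0 ++ concat (applyUpTo (f ∘ suc) M)   ≡⟨ cong (f 0 ++_) (concat-applyUpTo-[] f[1+m]≡[] M) ⟩
  f 0 ++ []                               ≡⟨ ++-identityʳ (f 0) ⟩
  f 0                                     ∎
  where open ≡-Reasoning

-- Martin-Löf tests from growing finite orders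

ifZero : ℕ → ℕ → ℕ
ifZero zero    x = x
ifZero (suc _) _ = 0

ifZero-code : Code 2
ifZero-code = prec π₀ zer

ifZero-eval : Computes₂ ifZero-code ifZero
ifZero-eval zero    x = ev-prec0 ev-proj
ifZero-eval (suc m) x = ev-precS (ifZero-eval m x) ev-zer

encodeSingleton-code : ∀ {n} → Code n → Code n
encodeSingleton-code c = comp₂ pair-code (const-code 1) (comp₂ pair-code c zer)

encodeSingleton-eval : ∀ {n} {c : Code n} {xs x} → Eval c xs x → Eval (encodeSingleton-code c) xs (encodeList (x ∷ []))
encodeSingleton-eval c-eval = ev-comp (const-eval 1 ∷ ev-comp (c-eval ∷ ev-zer ∷ []) (pair-eval _ 0) ∷ []) (pair-eval 1 _)

module ExtensionTest (ℓ : ℕ → List ℕ) (ℓ-rec : Rec1 (λ n → encodeList (ℓ n)))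
                     (ℓ-unique : ∀ n → Unique (ℓ n)) (ℓ-long : ∀ n → n < length (ℓ n)) where

  -- Level n of the test is the single set Z (ℓ n): every other m gets the code 0 of the empty union.
  φ : ℕ → ℕ → ℕ
  φ n m = ifZero m (encodeDNF (Z (ℓ n)))

  T-φ-zero : ∀ n → ZRep.T codeRep (φ n 0) ≡ Z (ℓ n)
  T-φ-zero n = decodeDNF-encodeDNF {Z (ℓ n)} ((ℓ-unique n ∷ []) ∷ [])

  T-φ-suc : ∀ n m → ZRep.T codeRep (φ n (suc m)) ≡ []
  T-φ-suc n m = refl

  encodeZ-code : Code 1
  encodeZ-code = encodeSingleton-code (encodeSingleton-code (comp₂ pair-code (const-code 1) (proj₁ ℓ-rec)))

  encodeZ-eval : Computes₁ encodeZ-code (λ n → encodeDNF (Z (ℓ n)))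
  encodeZ-eval n =
    encodeSingleton-eval (encodeSingleton-eval (ev-comp (const-eval 1 ∷ proj₂ ℓ-rec (n ∷ []) ∷ []) (pair-eval 1 _)))

  φ-rec : Rec2 φ
  φ-rec = comp₂ ifZero-code π₁ (comp₁ encodeZ-code π₀) ,
          λ { (n ∷ m ∷ []) → ev-comp (ev-proj ∷ ev-comp (ev-proj ∷ []) (encodeZ-eval n) ∷ []) (ifZero-eval m _) }

  small : ∀ k n M → k ≤ n → MeasureLE (concatMap (λ m → ZRep.T codeRep (φ n m)) (upTo M)) k
  small k n zero    _   = z≤n
  small k n (suc M) k≤n =
    subst (λ D → MeasureLE D k) (sym level-n) (measure-Z {ℓ n} k (ℓ-unique n) 2^k≤ℓ!)
    where
      level-n : concatMap (λ m → ZRep.T codeRep (φ n m)) (upTo (suc M)) ≡ Z (ℓ n)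
      level-n = trans (concatMap-upTo-suc (λ m → ZRep.T codeRep (φ n m)) M (T-φ-suc n)) (T-φ-zero n)

      open ≤-Reasoning
      2^k≤ℓ! : 2 ^ k ≤ length (ℓ n) !
      2^k≤ℓ! = begin
        2 ^ k          ≤⟨ ^-monoʳ-≤ 2 k≤n ⟩
        2 ^ n          ≤⟨ 2^n≤[1+n]! n ⟩
        suc n !        ≤⟨ !-mono-≤ (ℓ-long n) ⟩
        length (ℓ n) ! ∎

  test : MLTest
  test = record
    { rep = codeRep ; φ = φ ; φ-rec = φ-rec
    ; g = id ; g-rec = π₀ , λ { (k ∷ []) → ev-proj }
    ; small = small }

  covered : ∀ ξ → (∀ n → extendsB ξ (ℓ n) ≡ true) → Covered test ξ
  covered ξ extends n =
    0 , subst (λ D → evalDNF ξ D ≡ true) (sym (T-φ-zero n)) (trans (evalDNF-Z ξ (ℓ n)) (extends n))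

-- Recursive descending chains

extendsB-AllPairs : ∀ {r : ℕ → ℕ → Bool} {l} → AllPairs (λ x y → r x y ≡ true) l → extendsB r l ≡ true
extendsB-AllPairs             []                 = refl
extendsB-AllPairs {r} {x ∷ l} (x≺l ∷ l-sorted) =
  cong₂ _∧_ (Equivalence.to T-≡ (All.all⁻ (r x) (All.map (Equivalence.from T-≡) x≺l))) (extendsB-AllPairs l-sorted)

leastWitness : (P : ℕ → Bool) {w : ℕ} → P w ≡ true → Σ ℕ λ y → P y ≡ true × (∀ {z} → z < y → P z ≡ false)
leastWitness P {zero}  P0 = 0 , P0 , λ ()
leastWitness P {suc w} Pw with P 0 in P0
... | true  = 0 , P0 , λ ()
... | false with leastWitness (P ∘ suc) Pw
...   | y , Py , below-y = suc y , Py , λ { {zero} _ → P0 ; {suc z} (s≤s z<y) → below-y z<y }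

module DescendingChain {_≺_ : ℕ → ℕ → Bool} (≺-rec : Rec2 (λ x y → boolToℕ (x ≺ y)))
                       (≺-poset : IsStrictPoset _≺_) (no-minimal : ∀ x → Σ ℕ λ y → (y ≺ x) ≡ true) where

  open IsStrictPoset ≺-poset renaming (irrefl to ≺-irrefl; trans to ≺-trans)

  next : ℕ → ℕ
  next x = proj₁ (leastWitness (_≺ x) (proj₂ (no-minimal x)))

  next-≺ : ∀ x → (next x ≺ x) ≡ true
  next-≺ x = proj₁ (proj₂ (leastWitness (_≺ x) (proj₂ (no-minimal x))))

  next-least : ∀ x {z} → z < next x → (z ≺ x) ≡ false
  next-least x = proj₂ (proj₂ (leastWitness (_≺ x) (proj₂ (no-minimal x))))

  descent : ℕ → ℕ
  descent zero    = 0
  descent (suc n) = next (descent n)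

  descent-≺ : ∀ {i j} → j < i → (descent i ≺ descent j) ≡ true
  descent-≺ {suc i} j<1+i with m<1+n⇒m<n∨m≡n j<1+i
  ... | inj₁ j<i  = ≺-trans _ _ _ (next-≺ (descent i)) (descent-≺ j<i)
  ... | inj₂ refl = next-≺ (descent i)

  chain : ℕ → List ℕ
  chain n = applyDownFrom descent (suc n)

  chain-ascending : ∀ n → AllPairs (λ x y → (x ≺ y) ≡ true) (chain n)
  chain-ascending n = AllPairs.applyDownFrom⁺₁ descent (suc n) (λ j<i _ → descent-≺ j<i)

  chain-unique : ∀ n → Unique (chain n)
  chain-unique n = AllPairs.map irreflexive (chain-ascending n)
    where
      irreflexive : ∀ {x y} → (x ≺ y) ≡ true → x ≢ y
      irreflexive {x} x≺x refl with trans (sym (≺-irrefl x)) x≺x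
      ... | ()

  length-chain : ∀ n → length (chain n) ≡ suc n
  length-chain n = length-applyDownFrom descent (suc n)

  not-≺-code : Code 2
  not-≺-code = comp₂ ∸-code (const-code 1) (proj₁ ≺-rec)

  not-≺-eval : Computes₂ not-≺-code (λ z x → 1 ∸ boolToℕ (z ≺ x))
  not-≺-eval z x = ev-comp (const-eval 1 ∷ proj₂ ≺-rec (z ∷ x ∷ []) ∷ []) (∸-eval _ _)

  next-code : Code 1
  next-code = mini not-≺-code

  next-eval : Computes₁ next-code next
  next-eval x = ev-mini (subst (Eval _ _) (cong (λ b → 1 ∸ boolToℕ b) (next-≺ x)) (not-≺-eval (next x) x))
                        (λ z z<next → 0 , subst (Eval _ _) (cong (λ b → 1 ∸ boolToℕ b) (next-least x z<next))
                                                            (not-≺-eval z x))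

  descent-code : Code 1
  descent-code = prec zer (comp₁ next-code π₁)

  descent-eval : Computes₁ descent-code descent
  descent-eval zero    = ev-prec0 ev-zer
  descent-eval (suc n) = ev-precS (descent-eval n) (ev-comp (ev-proj ∷ []) (next-eval (descent n)))

  ⌜chain⌝-code : Code 1
  ⌜chain⌝-code = prec (const-code ⌜ chain 0 ⌝) (comp₂ pair-code (comp₁ descent-code (comp₁ succ π₀)) π₁)

  ⌜chain⌝-eval : Computes₁ ⌜chain⌝-code (λ n → ⌜ chain n ⌝)
  ⌜chain⌝-eval zero    = ev-prec0 (const-eval ⌜ chain 0 ⌝)
  ⌜chain⌝-eval (suc n) = ev-precS (⌜chain⌝-eval n)
    (ev-comp (ev-comp (ev-comp (ev-proj ∷ []) ev-succ ∷ []) (descent-eval (suc n)) ∷ ev-proj ∷ []) (pair-eval _ _))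

  encodeChain-code : Code 1
  encodeChain-code = comp₂ pair-code (comp₁ succ π₀) ⌜chain⌝-code

  chain-rec : Rec1 (λ n → encodeList (chain n))
  chain-rec = encodeChain-code ,
              λ { (n ∷ []) → subst (λ L → Eval encodeChain-code (n ∷ []) (pair L ⌜ chain n ⌝)) (sym (length-chain n))
                                   (ev-comp (ev-comp (ev-proj ∷ []) ev-succ ∷ ⌜chain⌝-eval n ∷ []) (pair-eval _ _)) }

twoChain : Fin 2 → Fin 2 → Bool
twoChain Fin.zero (Fin.suc Fin.zero) = true
twoChain _        _                  = false

twoChain-poset : IsStrictPoset twoChain
twoChain-poset = record { irrefl = irrefl ; trans = transitive }
  where
    irrefl : ∀ i → twoChain i i ≡ false
    irrefl Fin.zero           = refl
    irrefl (Fin.suc Fin.zero) = refl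

    transitive : ∀ i j k → twoChain i j ≡ true → twoChain j k ≡ true → twoChain i k ≡ true
    transitive Fin.zero (Fin.suc Fin.zero) Fin.zero           _ ()
    transitive Fin.zero (Fin.suc Fin.zero) (Fin.suc Fin.zero) _ ()

Fin1-injective : ∀ {A : Set} (f : Fin 1 → A) → Injective _≡_ _≡_ f
Fin1-injective f {Fin.zero} {Fin.zero} _ = refl

module _ {_≺_ : ℕ → ℕ → Bool} (U : UniversalPosetRep _≺_) where
  open UniversalPosetRep U using (age; homogeneous; poset)
  open IsStrictPoset poset using (irrefl)

  universal⇒no-minimal : ∀ x → Σ ℕ λ y → (y ≺ x) ≡ true
  universal⇒no-minimal x with age 2 twoChain twoChain-poset
  ... | e , _ , e-embeds with homogeneous 1 (λ _ → e (# 1)) (λ _ → x) (Fin1-injective _) (Fin1-injective _)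
                                           (λ _ _ → trans (irrefl (e (# 1))) (sym (irrefl x)))
  ...   | σ , _ , _ , _ , σ-preserves , σb≡x =
    σ (e (# 0)) , (begin
      σ (e (# 0)) ≺ x               ≡⟨ cong (σ (e (# 0)) ≺_) (σb≡x (# 0)) ⟨
      σ (e (# 0)) ≺ σ (e (# 1))     ≡⟨ σ-preserves (e (# 0)) (e (# 1)) ⟩
      e (# 0) ≺ e (# 1)             ≡⟨ e-embeds (# 0) (# 1) ⟨
      true                          ∎)
    where open ≡-Reasoning

mainTheorem2 : (_≺_ : ℕ → ℕ → Bool) → UniversalPosetRep _≺_ →
               (ξ : ℕ → ℕ → Bool) → IsTotalOrder ξ → LinExt _≺_ ξ →
               ¬ MLRandom ξ
mainTheorem2 _≺_ U ξ _ ξ-extends ξ-random = ξ-random test (covered ξ ξ-extends-chain)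
  where
    open DescendingChain (UniversalPosetRep.recursive U) (UniversalPosetRep.poset U) (universal⇒no-minimal U)
    open ExtensionTest chain chain-rec chain-unique (λ n → subst (n <_) (sym (length-chain n)) ≤-refl)

    ξ-extends-chain : ∀ n → extendsB ξ (chain n) ≡ true
    ξ-extends-chain n = extendsB-AllPairs (AllPairs.map (ξ-extends _ _) (chain-ascending n))
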